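{- Let $H$ be a finite even graph embedded in an oriented surface, with edge weights $K_e$ and fixed square roots $\sqrt{K_e}$. Then \[\prod_{e\in E(H)}K_e=\sum_{(M_v)_{v\in V(H)}}\prod_{v\in V(H)}w_c(M_v),\] where the sum is over all choices, for each vertex $v$, of a perfect matching $M_v$ of the complete graph on the set of edges incident to $v$.
   Context: For a matching $M$ at $v$, $w_c(M)=(-1)^{\mathrm{cr}(M)}\prod_{\{e,f\}\in M}\sqrt{K_e}\sqrt{K_f}$, where $\mathrm{cr}(M)$ is the number of unordered pairs of matched pairs $\{e_1,e_2\},\{f_1,f_2\}$ that cross, i.e. satisfy $e_1<f_1<e_2<f_2$ in the cyclic order of edges at $v$ induced by the orientation. -}

module Defs where

open import Level using (Level)
open import Data.Nat as ℕ using (ℕ; zero; suc)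
open import Data.Fin as Fin using (Fin; zero; suc)
open import Data.Fin.Properties as FinP using ()
open import Data.List using (List; []; _∷_; map; concatMap; filter; allFin; foldr; length; cartesianProduct)
open import Data.Bool using (Bool)
open import Data.Product using (_×_; _,_; proj₁; proj₂; Σ)
open import Relation.Nullary using (¬_)
open import Relation.Nullary.Decidable using (Dec; _×-dec_; ¬?)
open import Relation.Binary.PropositionalEquality using (_≡_)
open import Algebra.Bundles using (CommutativeRing)

-- A finite graph (loops and multiple edges allowed) together with a
-- rotation system, i.e. the combinatorial data of an embedding in an
-- oriented surface: at every vertex v the incident half-edges are listed
-- in the cyclic order induced by the orientation, as positions
-- 0 .. deg v - 1 (starting at an arbitrary half-edge).
-- A half-edge is a pair (e , b) : edge × end.

record EmbeddedGraph : Set where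
  field
    nV nE : ℕ
    ends  : Fin nE → Bool → Fin nV
    deg   : Fin nV → ℕ
    rot   : (v : Fin nV) → Fin (deg v) → Fin nE × Bool
    rot-at   : ∀ v i → ends (proj₁ (rot v i)) (proj₂ (rot v i)) ≡ v
    rot-inj  : ∀ v i j → rot v i ≡ rot v j → i ≡ j
    rot-surj : ∀ e b → Σ (Fin (deg (ends e b))) λ i → rot (ends e b) i ≡ (e , b)

  edgeAt : (v : Fin nV) → Fin (deg v) → Fin nE
  edgeAt v i = proj₁ (rot v i)

open EmbeddedGraph public

allFunctions : (n : ℕ) {B : Fin n → Set} → ((i : Fin n) → List (B i)) → List ((i : Fin n) → B i)
allFunctions zero ls = (λ ()) ∷ []
allFunctions (suc n) {B} ls =
  concatMap (λ b → map (cons b) (allFunctions n (λ i → ls (suc i)))) (ls zero)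
  where
  cons : B zero → ((i : Fin n) → B (suc i)) → (i : Fin (suc n)) → B i
  cons b f zero    = b
  cons b f (suc i) = f i

-- Perfect matchings of the complete graph on Fin k, encoded (bijectively)
-- as fixed-point-free involutions M (i is matched with M i).

IsPerfectMatching : (k : ℕ) → (Fin k → Fin k) → Set
IsPerfectMatching k M = ∀ i → M (M i) ≡ i × ¬ (M i ≡ i)

isPerfectMatching? : (k : ℕ) → (M : Fin k → Fin k) → Dec (IsPerfectMatching k M)
isPerfectMatching? k M = FinP.all? λ i → (M (M i) FinP.≟ i) ×-dec ¬? (M i FinP.≟ i)

matchings : (k : ℕ) → List (Fin k → Fin k)
matchings k = filter (isPerfectMatching? k) (allFunctions k (λ _ → allFin k))

-- cr(M): number of unordered pairs of matched pairs {a, M a}, {b, M b}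
-- with a < b < M a < M b (each crossing pair counted once, via its
-- smaller first endpoint a).
Crossing : (k : ℕ) → (Fin k → Fin k) → Fin k × Fin k → Set
Crossing k M (a , b) = (a Fin.< M a) × (b Fin.< M b) × (a Fin.< b) × (b Fin.< M a) × (M a Fin.< M b)

crossing? : (k : ℕ) (M : Fin k → Fin k) (p : Fin k × Fin k) → Dec (Crossing k M p)
crossing? k M (a , b) =
  (a FinP.<? M a) ×-dec (b FinP.<? M b) ×-dec (a FinP.<? b) ×-dec (b FinP.<? M a) ×-dec (M a FinP.<? M b)

cr : (k : ℕ) → (Fin k → Fin k) → ℕ
cr k M = length (filter (crossing? k M) (cartesianProduct (allFin k) (allFin k)))

module Weights {c ℓ : Level} (R : CommutativeRing c ℓ) where
  open CommutativeRing R

  sumR : List Carrier → Carrier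
  sumR = foldr _+_ 0#

  prodR : List Carrier → Carrier
  prodR = foldr _*_ 1#

  minusOnePow : ℕ → Carrier
  minusOnePow zero    = 1#
  minusOnePow (suc n) = - minusOnePow n

  -- w_c(M) = (-1)^{cr(M)} ∏_{{i, M i} ∈ M} √K_{e_i} √K_{e_{M i}}
  -- (each pair {i, M i} taken once, via i < M i)
  wc : (H : EmbeddedGraph) (sqrtK : Fin (nE H) → Carrier)
       (v : Fin (nV H)) → (Fin (deg H v) → Fin (deg H v)) → Carrier
  wc H sqrtK v M =
    minusOnePow (cr (deg H v) M) *
    prodR (map (λ i → sqrtK (edgeAt H v i) * sqrtK (edgeAt H v (M i)))
               (filter (λ i → i FinP.<? M i) (allFin (deg H v))))

  edgeProduct : (H : EmbeddedGraph) → (Fin (nE H) → Carrier) → Carrier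
  edgeProduct H K = prodR (map K (allFin (nE H)))

  matchingSum : (H : EmbeddedGraph) → (Fin (nE H) → Carrier) → Carrier
  matchingSum H sqrtK =
    sumR (map (λ Ms → prodR (map (λ v → wc H sqrtK v (Ms v)) (allFin (nV H))))
              (allFunctions (nV H) (λ v → matchings (deg H v))))

module Submission where

-- Write s = √K.  Expanding the product of sums, the right-hand side is
-- ∏_v Σ_{M_v} w_c(M_v).  For a perfect matching M at v, the product of
-- s(e_i) s(e_{M i}) over the pairs of M is the product of s over all
-- positions around v, so Σ_M w_c(M) = (Σ_M (-1)^{cr M}) · ∏_i s(e_i).  The
-- signed count Σ_M (-1)^{cr M} over the perfect matchings of K_{2q} is 1
-- (the Pfaffian of the all-ones skew matrix).  Finally every edge has two
-- ends, each occurring exactly once around its endpoint, so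
-- ∏_v ∏_i s(e_i) = ∏_e s(e)² = ∏_e K_e.
--
-- The signed count is proved by induction on q, summing over all maps
-- f : Fin 2q → Fin 2q with weight (-1)^{cr f} on perfect matchings and 0
-- elsewhere.  Maps with f 0 = 1 reduce to the case q - 1 after removing the
-- chord {0 , 1}; maps in which 0 and 1 have distinct partners ≥ 2 cancel in
-- pairs, because exchanging the labels 0 and 1 changes the crossing number
-- by exactly one.

open import Data.Nat as ℕ using (ℕ; zero; suc)
import Data.Nat.Properties as ℕP
open import Data.Nat.Divisibility using (_∣_; divides)
open import Data.Nat.Tactic.RingSolver using (solve-∀)
open import Data.Fin as Fin using (Fin; zero; suc)
import Data.Fin.Properties as FinP
open import Data.Fin.Permutation using (Permutation′; permutation)
open import Data.Vec.Functional using () renaming (_∷_ to _∷ᶠ_)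
open import Data.List using (List; []; _∷_; map; concatMap; filter; allFin; foldr; length; tabulate; _++_; cartesianProduct; cartesianProductWith)
open import Data.List.Properties using (map-++; map-tabulate; map-∘)
open import Data.Bool using (Bool; true; false)
import Data.Bool.Properties as BoolP
open import Data.Product using (Σ; _×_; _,_; proj₁; proj₂)
open import Data.Product.Properties using (≡-dec)
open import Data.Product.Function.NonDependent.Propositional using (_×-⇔_)
open import Data.Sum using (_⊎_; inj₁; inj₂)
open import Data.Empty using (⊥; ⊥-elim)
open import Data.Unit using (⊤; tt)
open import Function using (_∘_; id; _⇔_; mk⇔; Equivalence)
import Function.Properties.Equivalence as ⇔
open import Relation.Nullary using (Dec; yes; no; ¬_)
open import Relation.Unary using (Pred; Decidable)
open import Relation.Binary using (tri<; tri≈; tri>)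
open import Relation.Binary.PropositionalEquality as ≡ using (_≡_)
open import Algebra.Bundles using (CommutativeMonoid; CommutativeRing)
open import Defs

up : ∀ {m} → Fin m → Fin (suc (suc m))
up i = suc (suc i)

τ : ∀ {m} → Fin (suc (suc m)) → Fin (suc (suc m))
τ zero          = suc zero
τ (suc zero)    = zero
τ (suc (suc i)) = up i

τ-involutive : ∀ {m} (i : Fin (suc (suc m))) → τ (τ i) ≡ i
τ-involutive zero          = ≡.refl
τ-involutive (suc zero)    = ≡.refl
τ-involutive (suc (suc i)) = ≡.refl

module BigOp {a ℓ} (M : CommutativeMonoid a ℓ) where
  open CommutativeMonoid M
  open import Relation.Binary.Reasoning.Setoid setoid
  open import Algebra.Properties.CommutativeMonoid.Sum M public

  fold : List Carrier → Carrier
  fold = foldr _∙_ ε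

  onlyIf : ∀ {p} {A : Set p} → Dec A → Carrier → Carrier
  onlyIf (yes _) x = x
  onlyIf (no _)  _ = ε

  onlyIf-cong : ∀ {p q} {A : Set p} {B : Set q} (d : Dec A) (e : Dec B) {x y : Carrier} →
    A ⇔ B → (A → x ≈ y) → onlyIf d x ≈ onlyIf e y
  onlyIf-cong (yes a) (yes _) _  x≈y = x≈y a
  onlyIf-cong (yes a) (no ¬b) A⇔B _  = ⊥-elim (¬b (Equivalence.to A⇔B a))
  onlyIf-cong (no ¬a) (yes b) A⇔B _  = ⊥-elim (¬a (Equivalence.from A⇔B b))
  onlyIf-cong (no _)  (no _)  _   _  = refl

  onlyIf-holds : ∀ {p} {A : Set p} (d : Dec A) {x : Carrier} → A → onlyIf d x ≈ x
  onlyIf-holds (yes _) _ = refl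
  onlyIf-holds (no ¬a) a = ⊥-elim (¬a a)

  onlyIf-absurd : ∀ {p} {A : Set p} (d : Dec A) {x : Carrier} → ¬ A → onlyIf d x ≈ ε
  onlyIf-absurd (yes a) ¬a = ⊥-elim (¬a a)
  onlyIf-absurd (no _)  _  = refl

  fold-++ : ∀ xs ys → fold (xs ++ ys) ≈ fold xs ∙ fold ys
  fold-++ []       ys = sym (identityˡ _)
  fold-++ (x ∷ xs) ys = trans (∙-congˡ (fold-++ xs ys)) (sym (assoc _ _ _))

  fold-map-cong : ∀ {b} {B : Set b} {f g : B → Carrier} (xs : List B) →
    (∀ x → f x ≈ g x) → fold (map f xs) ≈ fold (map g xs)
  fold-map-cong []       f≈g = refl
  fold-map-cong (x ∷ xs) f≈g = ∙-cong (f≈g x) (fold-map-cong xs f≈g)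

  fold-concatMap : ∀ {b d} {B : Set b} {D : Set d} (h : D → Carrier) (g : B → List D) (xs : List B) →
    fold (map h (concatMap g xs)) ≈ fold (map (λ x → fold (map h (g x))) xs)
  fold-concatMap h g []       = refl
  fold-concatMap h g (x ∷ xs) = begin
    fold (map h (g x ++ concatMap g xs))          ≡⟨ ≡.cong fold (map-++ h (g x) (concatMap g xs)) ⟩
    fold (map h (g x) ++ map h (concatMap g xs))  ≈⟨ fold-++ (map h (g x)) _ ⟩
    fold (map h (g x)) ∙ fold (map h (concatMap g xs)) ≈⟨ ∙-congˡ (fold-concatMap h g xs) ⟩
    fold (map (λ x → fold (map h (g x))) (x ∷ xs)) ∎

  fold-filter : ∀ {b p} {B : Set b} {Q : Pred B p} (q : Decidable Q) (g : B → Carrier) (xs : List B) →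
    fold (map g (filter q xs)) ≈ fold (map (λ x → onlyIf (q x) (g x)) xs)
  fold-filter q g []       = refl
  fold-filter q g (x ∷ xs) with q x
  ... | yes _ = ∙-congˡ (fold-filter q g xs)
  ... | no _  = trans (fold-filter q g xs) (sym (identityˡ _))

  fold-filter-cong : ∀ {b p} {B : Set b} {Q : Pred B p} (q : Decidable Q) {g h : B → Carrier} (xs : List B) →
    (∀ x → Q x → g x ≈ h x) → fold (map g (filter q xs)) ≈ fold (map h (filter q xs))
  fold-filter-cong q []       g≈h = refl
  fold-filter-cong q (x ∷ xs) g≈h with q x
  ... | yes Qx = ∙-cong (g≈h x Qx) (fold-filter-cong q xs g≈h)
  ... | no _   = fold-filter-cong q xs g≈h

  fold-tabulate : ∀ {n} (f : Fin n → Carrier) → fold (tabulate f) ≡ sum f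
  fold-tabulate {zero}  f = ≡.refl
  fold-tabulate {suc n} f = ≡.cong (f zero ∙_) (fold-tabulate (f ∘ suc))

  fold-allFin : ∀ n (f : Fin n → Carrier) → fold (map f (allFin n)) ≡ sum f
  fold-allFin n f = ≡.trans (≡.cong fold (map-tabulate id f)) (fold-tabulate f)

  fold-cartesianProduct : ∀ {n} {B : Set} (h : Fin n × B → Carrier) (ys : List B) →
    fold (map h (cartesianProduct (allFin n) ys)) ≈ sum (λ i → fold (map (λ y → h (i , y)) ys))
  fold-cartesianProduct {n} h ys = go id
    where
    go : ∀ {m} (f : Fin m → Fin n) →
      fold (map h (cartesianProductWith _,_ (tabulate f) ys)) ≈ sum (λ i → fold (map (λ y → h (f i , y)) ys))
    go {zero}  f = refl
    go {suc m} f = begin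
      fold (map h (map (f zero ,_) ys ++ cartesianProductWith _,_ (tabulate (f ∘ suc)) ys))
        ≡⟨ ≡.cong fold (map-++ h (map (f zero ,_) ys) _) ⟩
      fold (map h (map (f zero ,_) ys) ++ map h (cartesianProductWith _,_ (tabulate (f ∘ suc)) ys))
        ≈⟨ fold-++ (map h (map (f zero ,_) ys)) _ ⟩
      fold (map h (map (f zero ,_) ys)) ∙ fold (map h (cartesianProductWith _,_ (tabulate (f ∘ suc)) ys))
        ≈⟨ ∙-cong (reflexive (≡.cong fold (≡.sym (map-∘ ys)))) (go (f ∘ suc)) ⟩
      sum (λ i → fold (map (λ y → h (f i , y)) ys)) ∎

  sum-zero : ∀ {n} {f : Fin n → Carrier} → (∀ i → f i ≈ ε) → sum f ≈ ε
  sum-zero {n} f≈ε = trans (sum-cong-≋ f≈ε) (sum-replicate-zero n)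

  sum-delta : ∀ {n} (j : Fin n) (x : Carrier) → sum (λ i → onlyIf (i FinP.≟ j) x) ≈ x
  sum-delta {suc n} zero x =
    trans (∙-congˡ (sum-zero {n} (λ i → onlyIf-absurd (suc i FinP.≟ zero) {x} λ ()))) (identityʳ x)
  sum-delta {suc n} (suc j) x = begin
    onlyIf (zero FinP.≟ suc j) x ∙ sum (λ i → onlyIf (suc i FinP.≟ suc j) x)
      ≈⟨ ∙-cong (onlyIf-absurd (zero FinP.≟ suc j) {x} λ ())
                (sum-cong-≋ λ i → onlyIf-cong (suc i FinP.≟ suc j) (i FinP.≟ j)
                                    (mk⇔ FinP.suc-injective (≡.cong suc)) (λ _ → refl)) ⟩
    ε ∙ sum (λ i → onlyIf (i FinP.≟ j) x) ≈⟨ identityˡ _ ⟩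
    sum (λ i → onlyIf (i FinP.≟ j) x) ≈⟨ sum-delta j x ⟩
    x ∎

  sum-τ : ∀ {m} (h : Fin (suc (suc m)) → Carrier) → sum (h ∘ τ) ≈ sum h
  sum-τ h = begin
    h (suc zero) ∙ (h zero ∙ r) ≈⟨ sym (assoc _ _ _) ⟩
    (h (suc zero) ∙ h zero) ∙ r ≈⟨ ∙-congʳ (comm _ _) ⟩
    (h zero ∙ h (suc zero)) ∙ r ≈⟨ assoc _ _ _ ⟩
    h zero ∙ (h (suc zero) ∙ r) ∎
    where r : Carrier
          r = sum (h ∘ up)

module ℕΣ = BigOp ℕP.+-0-commutativeMonoid

count : ∀ {p} {A : Set p} → Dec A → ℕ
count d = ℕΣ.onlyIf d 1

length-filter : ∀ {b p} {B : Set b} {Q : Pred B p} (q : Decidable Q) (xs : List B) →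
  length (filter q xs) ≡ ℕΣ.fold (map (count ∘ q) xs)
length-filter q []       = ≡.refl
length-filter q (x ∷ xs) with q x
... | yes _ = ≡.cong suc (length-filter q xs)
... | no _  = length-filter q xs

crossings : (k : ℕ) → (Fin k → Fin k) → ℕ
crossings k M = ℕΣ.sum λ a → ℕΣ.sum λ b → count (crossing? k M (a , b))

cr≡crossings : ∀ k M → cr k M ≡ crossings k M
cr≡crossings k M = begin
  length (filter (crossing? k M) (cartesianProduct (allFin k) (allFin k)))
    ≡⟨ length-filter (crossing? k M) (cartesianProduct (allFin k) (allFin k)) ⟩
  ℕΣ.fold (map (count ∘ crossing? k M) (cartesianProduct (allFin k) (allFin k)))
    ≡⟨ ℕΣ.fold-cartesianProduct (count ∘ crossing? k M) (allFin k) ⟩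
  ℕΣ.sum (λ a → ℕΣ.fold (map (λ b → count (crossing? k M (a , b))) (allFin k)))
    ≡⟨ ℕΣ.sum-cong-≗ {k} (λ a → ℕΣ.fold-allFin k _) ⟩
  crossings k M ∎
  where open ≡.≡-Reasoning

Interleaved : ∀ {k} → Fin k → Fin k → Fin k → Fin k → Set
Interleaved a b u w = (a Fin.< u) × (b Fin.< w) × (a Fin.< b) × (b Fin.< u) × (u Fin.< w)

crossing⇔interleaved : ∀ {k} (M : Fin k → Fin k) {a b u w} → M a ≡ u → M b ≡ w →
  Crossing k M (a , b) ⇔ Interleaved a b u w
crossing⇔interleaved M ≡.refl ≡.refl = ⇔.refl

interleaved-cong : ∀ {k k'} {a b u w : Fin k} {a' b' u' w' : Fin k'} →
  (a Fin.< u ⇔ a' Fin.< u') → (b Fin.< w ⇔ b' Fin.< w') → (a Fin.< b ⇔ a' Fin.< b') →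
  (b Fin.< u ⇔ b' Fin.< u') → (u Fin.< w ⇔ u' Fin.< w') → Interleaved a b u w ⇔ Interleaved a' b' u' w'
interleaved-cong au bw ab bu uw = au ×-⇔ bw ×-⇔ ab ×-⇔ bu ×-⇔ uw

crossings-cong : ∀ k {f g : Fin k → Fin k} → (∀ i → f i ≡ g i) → crossings k f ≡ crossings k g
crossings-cong k {f} {g} f≗g = ℕΣ.sum-cong-≗ λ a → ℕΣ.sum-cong-≗ λ b →
  ℕΣ.onlyIf-cong (crossing? k f (a , b)) (crossing? k g (a , b))
    (⇔.trans (crossing⇔interleaved f ≡.refl ≡.refl) (⇔.sym (crossing⇔interleaved g (≡.sym (f≗g a)) (≡.sym (f≗g b)))))
    (λ _ → ≡.refl)

isPerfectMatching-cong : ∀ k {f g : Fin k → Fin k} → (∀ i → f i ≡ g i) →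
  IsPerfectMatching k f → IsPerfectMatching k g
isPerfectMatching-cong k {f} {g} f≗g pm i =
  ≡.trans (≡.cong g (≡.sym (f≗g i))) (≡.trans (≡.sym (f≗g (f i))) (proj₁ (pm i))) ,
  λ gi≡i → proj₂ (pm i) (≡.trans (f≗g i) gi≡i)

conj : ∀ {m} → (Fin (suc (suc m)) → Fin (suc (suc m))) → Fin (suc (suc m)) → Fin (suc (suc m))
conj f = τ ∘ f ∘ τ

NotSwap : ∀ {m} → Fin (suc (suc m)) → Fin (suc (suc m)) → Set
NotSwap zero       (suc zero) = ⊥
NotSwap (suc zero) zero       = ⊥
NotSwap _          _          = ⊤

notSwap-upʳ : ∀ {m} (a : Fin (suc (suc m))) (p : Fin m) → NotSwap a (up p)
notSwap-upʳ zero          p = tt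
notSwap-upʳ (suc zero)    p = tt
notSwap-upʳ (suc (suc i)) p = tt

notSwap-upˡ : ∀ {m} (p : Fin m) (a : Fin (suc (suc m))) → NotSwap (up p) a
notSwap-upˡ p zero          = tt
notSwap-upˡ p (suc zero)    = tt
notSwap-upˡ p (suc (suc i)) = tt

τ-monotone : ∀ {m} (u v : Fin (suc (suc m))) → NotSwap u v → (τ u Fin.< τ v ⇔ u Fin.< v)
τ-monotone zero          zero          _ = mk⇔ (λ { (ℕ.s≤s ()) }) (λ ())
τ-monotone zero          (suc (suc j)) _ = mk⇔ (λ _ → ℕ.s≤s ℕ.z≤n) (λ _ → ℕ.s≤s (ℕ.s≤s ℕ.z≤n))
τ-monotone (suc zero)    (suc zero)    _ = mk⇔ (λ ()) (λ { (ℕ.s≤s ()) })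
τ-monotone (suc zero)    (suc (suc j)) _ = mk⇔ (λ _ → ℕ.s≤s (ℕ.s≤s ℕ.z≤n)) (λ _ → ℕ.s≤s ℕ.z≤n)
τ-monotone (suc (suc i)) zero          _ = mk⇔ (λ { (ℕ.s≤s ()) }) (λ ())
τ-monotone (suc (suc i)) (suc zero)    _ = mk⇔ (λ ()) (λ { (ℕ.s≤s ()) })
τ-monotone (suc (suc i)) (suc (suc j)) _ = ⇔.refl

Low : ∀ {m} → Fin (suc (suc m)) → Set
Low u = u ≡ zero ⊎ u ≡ suc zero

τ-low : ∀ {m} {u : Fin (suc (suc m))} → Low u → Low (τ u)
τ-low (inj₁ ≡.refl) = inj₂ ≡.refl
τ-low (inj₂ ≡.refl) = inj₁ ≡.refl

up≮low : ∀ {m} {p : Fin m} {u : Fin (suc (suc m))} → Low u → ¬ (up p Fin.< u)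
up≮low (inj₁ ≡.refl) ()
up≮low (inj₂ ≡.refl) (ℕ.s≤s ())

double-sum-off-swap : ∀ {m} (V W : Fin (suc (suc m)) → Fin (suc (suc m)) → ℕ) →
  (∀ a b → NotSwap a b → V a b ≡ W a b) →
  ℕΣ.sum (λ a → ℕΣ.sum (V a)) ℕ.+ (W zero (suc zero) ℕ.+ W (suc zero) zero)
    ≡ ℕΣ.sum (λ a → ℕΣ.sum (W a)) ℕ.+ (V zero (suc zero) ℕ.+ V (suc zero) zero)
double-sum-off-swap {m} V W V≡W = begin
  ℕΣ.sum (λ a → ℕΣ.sum (V a)) ℕ.+ (W₀₁ ℕ.+ W₁₀)
    ≡⟨ exchange (V zero zero) V₀₁ (rest V zero) V₁₀ (V (suc zero) (suc zero)) (rest V (suc zero)) (lower V) W₀₁ W₁₀ ⟩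
  ((V zero zero ℕ.+ (W₀₁ ℕ.+ rest V zero))
    ℕ.+ ((W₁₀ ℕ.+ (V (suc zero) (suc zero) ℕ.+ rest V (suc zero))) ℕ.+ lower V)) ℕ.+ (V₀₁ ℕ.+ V₁₀)
    ≡⟨ ≡.cong (ℕ._+ (V₀₁ ℕ.+ V₁₀))
         (≡.cong₂ ℕ._+_ (≡.cong₂ ℕ._+_ (V≡W zero zero tt) (≡.cong (W₀₁ ℕ.+_) (rest-agree zero)))
                        (≡.cong₂ ℕ._+_ (≡.cong (W₁₀ ℕ.+_) (≡.cong₂ ℕ._+_ (V≡W (suc zero) (suc zero) tt) (rest-agree (suc zero))))
                                       (ℕΣ.sum-cong-≗ λ a → ℕΣ.sum-cong-≗ λ b → V≡W (up a) b (notSwap-upˡ a b)))) ⟩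
  ℕΣ.sum (λ a → ℕΣ.sum (W a)) ℕ.+ (V₀₁ ℕ.+ V₁₀) ∎
  where
  open ≡.≡-Reasoning
  V₀₁ V₁₀ W₀₁ W₁₀ : ℕ
  V₀₁ = V zero (suc zero)
  V₁₀ = V (suc zero) zero
  W₀₁ = W zero (suc zero)
  W₁₀ = W (suc zero) zero
  rest : (Fin (suc (suc m)) → Fin (suc (suc m)) → ℕ) → Fin (suc (suc m)) → ℕ
  rest U a = ℕΣ.sum (λ b → U a (up b))
  lower : (Fin (suc (suc m)) → Fin (suc (suc m)) → ℕ) → ℕ
  lower U = ℕΣ.sum (λ a → ℕΣ.sum (U (up a)))
  rest-agree : ∀ a → rest V a ≡ rest W a
  rest-agree a = ℕΣ.sum-cong-≗ λ b → V≡W a (up b) (notSwap-upʳ a b)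
  exchange : ∀ a b c d e f g b' d' →
    ((a ℕ.+ (b ℕ.+ c)) ℕ.+ ((d ℕ.+ (e ℕ.+ f)) ℕ.+ g)) ℕ.+ (b' ℕ.+ d')
      ≡ ((a ℕ.+ (b' ℕ.+ c)) ℕ.+ ((d' ℕ.+ (e ℕ.+ f)) ℕ.+ g)) ℕ.+ (b ℕ.+ d)
  exchange = solve-∀

crossing-01 : ∀ {m} (g : Fin (suc (suc m)) → Fin (suc (suc m))) {x y : Fin m} →
  g zero ≡ up x → g (suc zero) ≡ up y → Crossing (suc (suc m)) g (zero , suc zero) ⇔ x Fin.< y
crossing-01 g g0 g1 = ⇔.trans (crossing⇔interleaved g g0 g1) (mk⇔
  (λ { (_ , _ , _ , _ , ℕ.s≤s (ℕ.s≤s x<y)) → x<y })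
  (λ x<y → ℕ.s≤s ℕ.z≤n , ℕ.s≤s (ℕ.s≤s ℕ.z≤n) , ℕ.s≤s ℕ.z≤n , ℕ.s≤s (ℕ.s≤s ℕ.z≤n) , ℕ.s≤s (ℕ.s≤s x<y)))

no-crossing-10 : ∀ {m} (g : Fin (suc (suc m)) → Fin (suc (suc m))) → ¬ Crossing (suc (suc m)) g (suc zero , zero)
no-crossing-10 g (_ , _ , () , _)

equal-partners-not-matching : ∀ {m} (f : Fin (suc (suc m)) → Fin (suc (suc m))) →
  f zero ≡ f (suc zero) → ¬ IsPerfectMatching (suc (suc m)) f
equal-partners-not-matching f f0≡f1 pm
  with ≡.trans (≡.sym (proj₁ (pm zero))) (≡.trans (≡.cong f f0≡f1) (proj₁ (pm (suc zero))))
... | ()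

high-low-not-matching : ∀ {m} (f : Fin (suc (suc m)) → Fin (suc (suc m))) {x : Fin m} →
  f zero ≡ up x → Low (f (suc zero)) → ¬ IsPerfectMatching (suc (suc m)) f
high-low-not-matching f f0 (inj₁ f1≡0) pm with ≡.trans (≡.sym f0) (≡.trans (≡.sym (≡.cong f f1≡0)) (proj₁ (pm (suc zero))))
... | ()
high-low-not-matching f f0 (inj₂ f1≡1) pm = proj₂ (pm (suc zero)) f1≡1

conj-matching : ∀ {m} (f : Fin (suc (suc m)) → Fin (suc (suc m))) →
  IsPerfectMatching (suc (suc m)) f → IsPerfectMatching (suc (suc m)) (conj f)
conj-matching f pm i =
  ≡.trans (≡.cong (τ ∘ f) (τ-involutive (f (τ i)))) (≡.trans (≡.cong τ (proj₁ (pm (τ i)))) (τ-involutive i)) ,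
  λ e → proj₂ (pm (τ i)) (≡.trans (≡.sym (τ-involutive (f (τ i)))) (≡.cong τ e))

-- Exchanging the labels 0 and 1 of a perfect matching in which they have
-- distinct partners up x, up y changes the crossing number by exactly one:
-- only the relative position of the chords at 0 and at 1 changes.
module ExchangeParity {m : ℕ} (f : Fin (suc (suc m)) → Fin (suc (suc m)))
  (pm : IsPerfectMatching (suc (suc m)) f) {x y : Fin m}
  (f0 : f zero ≡ up x) (f1 : f (suc zero) ≡ up y) where

  private
    K : ℕ
    K = suc (suc m)
    C : Fin K → Fin K
    C = conj f

  C-τ : ∀ a → C (τ a) ≡ τ (f a)
  C-τ a = ≡.cong (τ ∘ f) (τ-involutive a)

  partner-of-low : ∀ a → Low (f a) → Σ (Fin m) λ p → a ≡ up p
  partner-of-low a (inj₁ fa≡0) = x , ≡.trans (≡.sym (proj₁ (pm a))) (≡.trans (≡.cong f fa≡0) f0)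
  partner-of-low a (inj₂ fa≡1) = y , ≡.trans (≡.sym (proj₁ (pm a))) (≡.trans (≡.cong f fa≡1) f1)

  descends : ∀ a → Low (f a) → ¬ (a Fin.< f a) × ¬ (τ a Fin.< C (τ a))
  descends a low with partner-of-low a low
  ... | p , ≡.refl = up≮low low , λ lt → up≮low (τ-low low) (≡.subst (up p Fin.<_) (C-τ a) lt)

  both-absurd : ∀ {A B : Set} → ¬ A → ¬ B → A ⇔ B
  both-absurd ¬a ¬b = mk⇔ (⊥-elim ∘ ¬a) (⊥-elim ∘ ¬b)

  -- Away from the pair (0 , 1), the relabelled pair crosses in C iff the
  -- original pair crosses in f: τ preserves all the comparisons involved.
  crossing-exchange : ∀ a b → NotSwap a b → Crossing K C (τ a , τ b) ⇔ Crossing K f (a , b)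
  crossing-exchange a b ns = by-partners (f a) (f b) ≡.refl ≡.refl
    where
    low-a : Low (f a) → Crossing K C (τ a , τ b) ⇔ Crossing K f (a , b)
    low-a low = both-absurd (proj₂ (descends a low) ∘ proj₁) (proj₁ (descends a low) ∘ proj₁)
    low-b : Low (f b) → Crossing K C (τ a , τ b) ⇔ Crossing K f (a , b)
    low-b low = both-absurd (proj₂ (descends b low) ∘ proj₁ ∘ proj₂) (proj₁ (descends b low) ∘ proj₁ ∘ proj₂)
    by-partners : ∀ u w → f a ≡ u → f b ≡ w → Crossing K C (τ a , τ b) ⇔ Crossing K f (a , b)
    by-partners zero          _             fa _  = low-a (inj₁ fa)
    by-partners (suc zero)    _             fa _  = low-a (inj₂ fa)
    by-partners (suc (suc p)) zero          _  fb = low-b (inj₁ fb)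
    by-partners (suc (suc p)) (suc zero)    _  fb = low-b (inj₂ fb)
    by-partners (suc (suc p)) (suc (suc q)) fa fb =
      ⇔.trans (crossing⇔interleaved C (≡.trans (C-τ a) (≡.cong τ fa)) (≡.trans (C-τ b) (≡.cong τ fb)))
        (⇔.trans (interleaved-cong (τ-monotone a (up p) (notSwap-upʳ a p)) (τ-monotone b (up q) (notSwap-upʳ b q))
                                   (τ-monotone a b ns) (τ-monotone b (up p) (notSwap-upʳ b p)) ⇔.refl)
          (⇔.sym (crossing⇔interleaved f fa fb)))

  -- summing over all pairs, only the pairs (0 , 1) and (1 , 0) contribute differently
  crossings-exchange : count (x FinP.<? y) ℕ.+ crossings K C ≡ count (y FinP.<? x) ℕ.+ crossings K f
  crossings-exchange = begin
    count (x FinP.<? y) ℕ.+ crossings K C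
      ≡⟨ ≡.cong₂ ℕ._+_ (≡.sym Z₀₁) (≡.sym (crossings-reindexed)) ⟩
    Z zero (suc zero) ℕ.+ ΣΣ Y                          ≡⟨ ℕP.+-comm _ (ΣΣ Y) ⟩
    ΣΣ Y ℕ.+ Z zero (suc zero)                          ≡⟨ ≡.cong (ΣΣ Y ℕ.+_) (≡.sym (ℕP.+-identityʳ _)) ⟩
    ΣΣ Y ℕ.+ (Z zero (suc zero) ℕ.+ 0)                  ≡⟨ ≡.cong (λ z → ΣΣ Y ℕ.+ (Z zero (suc zero) ℕ.+ z)) (≡.sym Z₁₀) ⟩
    ΣΣ Y ℕ.+ (Z zero (suc zero) ℕ.+ Z (suc zero) zero) ≡⟨ double-sum-off-swap Y Z Y≡Z ⟩
    ΣΣ Z ℕ.+ (Y zero (suc zero) ℕ.+ Y (suc zero) zero) ≡⟨ ≡.cong (λ z → ΣΣ Z ℕ.+ (z ℕ.+ Y (suc zero) zero)) Y₀₁ ⟩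
    ΣΣ Z ℕ.+ Y (suc zero) zero                          ≡⟨ ℕP.+-comm (ΣΣ Z) _ ⟩
    Y (suc zero) zero ℕ.+ crossings K f                 ≡⟨ ≡.cong (ℕ._+ crossings K f) Y₁₀ ⟩
    count (y FinP.<? x) ℕ.+ crossings K f ∎
    where
    open ≡.≡-Reasoning
    Y Z : Fin K → Fin K → ℕ
    Y a b = count (crossing? K C (τ a , τ b))
    Z a b = count (crossing? K f (a , b))
    ΣΣ : (Fin K → Fin K → ℕ) → ℕ
    ΣΣ U = ℕΣ.sum λ a → ℕΣ.sum (U a)
    Y≡Z : ∀ a b → NotSwap a b → Y a b ≡ Z a b
    Y≡Z a b ns = ℕΣ.onlyIf-cong (crossing? K C (τ a , τ b)) (crossing? K f (a , b)) (crossing-exchange a b ns) (λ _ → ≡.refl)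
    crossings-reindexed : ΣΣ Y ≡ crossings K C
    crossings-reindexed = ≡.trans (ℕΣ.sum-τ (λ a → ℕΣ.sum λ b → count (crossing? K C (a , τ b))))
                                  (ℕΣ.sum-cong-≗ λ a → ℕΣ.sum-τ λ b → count (crossing? K C (a , b)))
    Z₀₁ : Z zero (suc zero) ≡ count (x FinP.<? y)
    Z₀₁ = ℕΣ.onlyIf-cong (crossing? K f (zero , suc zero)) (x FinP.<? y) (crossing-01 f f0 f1) (λ _ → ≡.refl)
    Y₁₀ : Y (suc zero) zero ≡ count (y FinP.<? x)
    Y₁₀ = ℕΣ.onlyIf-cong (crossing? K C (zero , suc zero)) (y FinP.<? x) (crossing-01 C (≡.cong τ f1) (≡.cong τ f0)) (λ _ → ≡.refl)
    Z₁₀ : Z (suc zero) zero ≡ 0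
    Z₁₀ = ℕΣ.onlyIf-absurd (crossing? K f (suc zero , zero)) (no-crossing-10 f)
    Y₀₁ : Y zero (suc zero) ≡ 0
    Y₀₁ = ℕΣ.onlyIf-absurd (crossing? K C (suc zero , zero)) (no-crossing-10 C)

  partners-distinct : ¬ x ≡ y
  partners-distinct ≡.refl = equal-partners-not-matching f (≡.trans f0 (≡.sym f1)) pm

  exchange-parity : suc (crossings K C) ≡ crossings K f ⊎ crossings K C ≡ suc (crossings K f)
  exchange-parity with FinP.<-cmp x y
  ... | tri< x<y _ y≮x = inj₁ (begin
    1 ℕ.+ crossings K C                   ≡⟨ ≡.cong (ℕ._+ crossings K C) (≡.sym (ℕΣ.onlyIf-holds (x FinP.<? y) x<y)) ⟩
    count (x FinP.<? y) ℕ.+ crossings K C ≡⟨ crossings-exchange ⟩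
    count (y FinP.<? x) ℕ.+ crossings K f ≡⟨ ≡.cong (ℕ._+ crossings K f) (ℕΣ.onlyIf-absurd (y FinP.<? x) y≮x) ⟩
    crossings K f ∎)
    where open ≡.≡-Reasoning
  ... | tri≈ _ x≡y _ = ⊥-elim (partners-distinct x≡y)
  ... | tri> x≮y _ y<x = inj₂ (begin
    crossings K C                         ≡⟨ ≡.cong (ℕ._+ crossings K C) (≡.sym (ℕΣ.onlyIf-absurd (x FinP.<? y) x≮y)) ⟩
    count (x FinP.<? y) ℕ.+ crossings K C ≡⟨ crossings-exchange ⟩
    count (y FinP.<? x) ℕ.+ crossings K f ≡⟨ ≡.cong (ℕ._+ crossings K f) (ℕΣ.onlyIf-holds (y FinP.<? x) y<x) ⟩
    1 ℕ.+ crossings K f ∎)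
    where open ≡.≡-Reasoning

withChord01 : ∀ {m} → (Fin m → Fin m) → Fin (suc (suc m)) → Fin (suc (suc m))
withChord01 h zero          = suc zero
withChord01 h (suc zero)    = zero
withChord01 h (suc (suc i)) = up (h i)

withChord01-matching⇔ : ∀ m (h : Fin m → Fin m) →
  IsPerfectMatching (suc (suc m)) (withChord01 h) ⇔ IsPerfectMatching m h
withChord01-matching⇔ m h = mk⇔
  (λ pm i → FinP.suc-injective (FinP.suc-injective (proj₁ (pm (up i)))) , λ e → proj₂ (pm (up i)) (≡.cong up e))
  (λ { pm zero          → ≡.refl , λ ()
     ; pm (suc zero)    → ≡.refl , λ ()
     ; pm (suc (suc i)) → ≡.cong up (proj₁ (pm i)) , λ e → proj₂ (pm i) (FinP.suc-injective (FinP.suc-injective e)) })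

-- The chord {0 , 1} crosses nothing, so it does not change the crossing number.
crossings-withChord01 : ∀ {m} (h : Fin m → Fin m) → crossings (suc (suc m)) (withChord01 h) ≡ crossings m h
crossings-withChord01 {m} h =
  ≡.cong₂ ℕ._+_ (ℕΣ.sum-zero {suc (suc m)} (λ b → ℕΣ.onlyIf-absurd (crossing? K F (zero , b)) {1} (from-0 b)))
    (≡.cong₂ ℕ._+_ (ℕΣ.sum-zero {suc (suc m)} (λ b → ℕΣ.onlyIf-absurd (crossing? K F (suc zero , b)) {1} from-1))
      (ℕΣ.sum-cong-≗ λ a → ≡.cong₂ ℕ._+_ (ℕΣ.onlyIf-absurd (crossing? K F (up a , zero)) to-0)
        (≡.cong₂ ℕ._+_ (ℕΣ.onlyIf-absurd (crossing? K F (up a , suc zero)) to-1)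
          (ℕΣ.sum-cong-≗ λ b → ℕΣ.onlyIf-cong (crossing? K F (up a , up b)) (crossing? m h (a , b)) (shifted a b) (λ _ → ≡.refl)))))
  where
  K : ℕ
  K = suc (suc m)
  F : Fin K → Fin K
  F = withChord01 h
  -- nothing lies strictly between 0 and its partner 1
  from-0 : ∀ b → ¬ Crossing K F (zero , b)
  from-0 zero    (_ , _ , () , _)
  from-0 (suc b) (_ , _ , _ , ℕ.s≤s () , _)
  -- 1 lies above its partner 0
  from-1 : ∀ {b} → ¬ Crossing K F (suc zero , b)
  from-1 ()
  -- no later pair starts at 0 or 1
  to-0 : ∀ {a} → ¬ Crossing K F (a , zero)
  to-0 (_ , _ , () , _)
  to-1 : ∀ {a} → ¬ Crossing K F (up a , suc zero)
  to-1 (_ , _ , ℕ.s≤s () , _)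
  shift : ∀ {u v : Fin m} → (up u Fin.< up v) ⇔ (u Fin.< v)
  shift = mk⇔ (λ { (ℕ.s≤s (ℕ.s≤s u<v)) → u<v }) (λ u<v → ℕ.s≤s (ℕ.s≤s u<v))
  shifted : ∀ a b → Crossing K F (up a , up b) ⇔ Crossing m h (a , b)
  shifted a b = shift ×-⇔ shift ×-⇔ shift ×-⇔ shift ×-⇔ shift

-- The weights live in a commutative ring R.  Σ+ gives sums and Π* gives
-- products (the sums of the multiplicative monoid).
module WithRing {c ℓ} (R : CommutativeRing c ℓ) where
  open CommutativeRing R hiding (zero)
  open Weights R
  open import Relation.Binary.Reasoning.Setoid setoid
  open import Algebra.Properties.Ring ring using (-0#≈0#; -‿involutive)
  module Σ+ = BigOp +-commutativeMonoid
  module Π* = BigOp *-commutativeMonoid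

  sumFun : (n k : ℕ) → ((Fin n → Fin k) → Carrier) → Carrier
  sumFun zero    k F = F (λ ())
  sumFun (suc n) k F = Σ+.sum λ x → sumFun n k (λ g → F (x ∷ᶠ g))

  Extensional : (n k : ℕ) → ((Fin n → Fin k) → Carrier) → Set _
  Extensional n k F = ∀ f g → (∀ i → f i ≡ g i) → F f ≈ F g

  extensional-∷ : ∀ {n k} F → Extensional (suc n) k F → ∀ x → Extensional n k (λ g → F (x ∷ᶠ g))
  extensional-∷ F ext x f g f≗g = ext _ _ λ { zero → ≡.refl ; (suc i) → f≗g i }

  sumFun-cong : ∀ n k {F G} → (∀ f → F f ≈ G f) → sumFun n k F ≈ sumFun n k G
  sumFun-cong zero    k F≈G = F≈G _
  sumFun-cong (suc n) k F≈G = Σ+.sum-cong-≋ λ x → sumFun-cong n k λ g → F≈G (x ∷ᶠ g)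

  sumFun-zero : ∀ n k {F} → (∀ f → F f ≈ 0#) → sumFun n k F ≈ 0#
  sumFun-zero zero    k F≈0 = F≈0 _
  sumFun-zero (suc n) k F≈0 = Σ+.sum-zero λ x → sumFun-zero n k λ g → F≈0 (x ∷ᶠ g)

  sumFun-+ : ∀ n k (F G : (Fin n → Fin k) → Carrier) → sumFun n k (λ f → F f + G f) ≈ sumFun n k F + sumFun n k G
  sumFun-+ zero    k F G = refl
  sumFun-+ (suc n) k F G = trans (Σ+.sum-cong-≋ λ x → sumFun-+ n k (λ g → F (x ∷ᶠ g)) (λ g → G (x ∷ᶠ g)))
                                 (Σ+.∑-distrib-+ (λ x → sumFun n k (λ g → F (x ∷ᶠ g))) (λ x → sumFun n k (λ g → G (x ∷ᶠ g))))

  fold-allFunctions : ∀ n k (F : (Fin n → Fin k) → Carrier) → Extensional n k F →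
    Σ+.fold (map F (allFunctions n (λ _ → allFin k))) ≈ sumFun n k F
  fold-allFunctions zero    k F ext = +-identityʳ _
  fold-allFunctions (suc n) k F ext = begin
    Σ+.fold (map F (allFunctions (suc n) (λ _ → allFin k))) ≈⟨ Σ+.fold-concatMap F _ (allFin k) ⟩
    Σ+.fold (map _ (allFin k))                             ≈⟨ Σ+.fold-map-cong (allFin k) (per-value _ λ { _ _ zero → ≡.refl ; _ _ (suc i) → ≡.refl }) ⟩
    Σ+.fold (map (λ x → sumFun n k (λ g → F (x ∷ᶠ g))) (allFin k)) ≡⟨ Σ+.fold-allFin k _ ⟩
    sumFun (suc n) k F ∎
    where
    L : List (Fin n → Fin k)
    L = allFunctions n (λ _ → allFin k)
    -- the enumeration prepends each first value x by a local copy of _∷ᶠ_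
    per-value : (cons : Fin k → (Fin n → Fin k) → Fin (suc n) → Fin k) → (∀ x g i → cons x g i ≡ (x ∷ᶠ g) i) →
      ∀ x → Σ+.fold (map F (map (cons x) L)) ≈ sumFun n k (λ g → F (x ∷ᶠ g))
    per-value cons cons≗∷ x = begin
      Σ+.fold (map F (map (cons x) L))      ≡⟨ ≡.cong Σ+.fold (≡.sym (map-∘ L)) ⟩
      Σ+.fold (map (λ g → F (cons x g)) L)  ≈⟨ Σ+.fold-map-cong L (λ g → ext _ _ (cons≗∷ x g)) ⟩
      Σ+.fold (map (λ g → F (x ∷ᶠ g)) L)    ≈⟨ fold-allFunctions n k _ (extensional-∷ F ext x) ⟩
      sumFun n k (λ g → F (x ∷ᶠ g)) ∎

  sumFun-postcompose-τ : ∀ n m (F : (Fin n → Fin (suc (suc m))) → Carrier) → Extensional n (suc (suc m)) F →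
    sumFun n (suc (suc m)) (λ f → F (τ ∘ f)) ≈ sumFun n (suc (suc m)) F
  sumFun-postcompose-τ zero    m F ext = ext _ _ (λ ())
  sumFun-postcompose-τ (suc n) m F ext = begin
    Σ+.sum (λ x → sumFun n K (λ g → F (τ ∘ (x ∷ᶠ g))))
      ≈⟨ Σ+.sum-cong-≋ {K} (λ x → sumFun-cong n K λ g → ext (τ ∘ (x ∷ᶠ g)) (τ x ∷ᶠ (τ ∘ g)) λ { zero → ≡.refl ; (suc i) → ≡.refl }) ⟩
    Σ+.sum (λ x → sumFun n K (λ g → F (τ x ∷ᶠ (τ ∘ g))))
      ≈⟨ Σ+.sum-cong-≋ (λ x → sumFun-postcompose-τ n m (λ g → F (τ x ∷ᶠ g)) (extensional-∷ F ext (τ x))) ⟩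
    Σ+.sum (λ x → sumFun n K (λ g → F (τ x ∷ᶠ g)))
      ≈⟨ Σ+.sum-τ (λ x → sumFun n K (λ g → F (x ∷ᶠ g))) ⟩
    Σ+.sum (λ x → sumFun n K (λ g → F (x ∷ᶠ g))) ∎
    where K : ℕ
          K = suc (suc m)

  sumFun-precompose-τ : ∀ m k (F : (Fin (suc (suc m)) → Fin k) → Carrier) → Extensional (suc (suc m)) k F →
    sumFun (suc (suc m)) k (λ f → F (f ∘ τ)) ≈ sumFun (suc (suc m)) k F
  sumFun-precompose-τ m k F ext = begin
    Σ+.sum (λ x → Σ+.sum (λ y → sumFun m k (λ g → F ((x ∷ᶠ (y ∷ᶠ g)) ∘ τ))))
      ≈⟨ Σ+.sum-cong-≋ {k} (λ x → Σ+.sum-cong-≋ {k} λ y → sumFun-cong m k λ g →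
           ext ((x ∷ᶠ (y ∷ᶠ g)) ∘ τ) (y ∷ᶠ (x ∷ᶠ g)) λ { zero → ≡.refl ; (suc zero) → ≡.refl ; (suc (suc i)) → ≡.refl }) ⟩
    Σ+.sum (λ x → Σ+.sum (λ y → sumFun m k (λ g → F (y ∷ᶠ (x ∷ᶠ g)))))
      ≈⟨ Σ+.∑-comm (λ x y → sumFun m k (λ g → F (y ∷ᶠ (x ∷ᶠ g)))) ⟩
    Σ+.sum (λ y → Σ+.sum (λ x → sumFun m k (λ g → F (y ∷ᶠ (x ∷ᶠ g))))) ∎

  sumFun-conj : ∀ m (F : (Fin (suc (suc m)) → Fin (suc (suc m))) → Carrier) → Extensional (suc (suc m)) (suc (suc m)) F →
    sumFun (suc (suc m)) (suc (suc m)) (λ f → F (conj f)) ≈ sumFun (suc (suc m)) (suc (suc m)) F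
  sumFun-conj m F ext = trans (sumFun-precompose-τ m _ (λ f → F (τ ∘ f)) (λ f g f≗g → ext _ _ (≡.cong τ ∘ f≗g)))
                              (sumFun-postcompose-τ (suc (suc m)) m F ext)

  sumFun-avoiding-01 : ∀ n k (G : (Fin n → Fin (suc (suc k))) → Carrier) → Extensional n (suc (suc k)) G →
    (∀ g i → Low (g i) → G g ≈ 0#) → sumFun n (suc (suc k)) G ≈ sumFun n k (λ h → G (up ∘ h))
  sumFun-avoiding-01 zero    k G ext G-low = ext _ _ (λ ())
  sumFun-avoiding-01 (suc n) k G ext G-low = begin
    sumFun (suc n) K G
      ≈⟨ +-cong (sumFun-zero n K (λ g → G-low (zero ∷ᶠ g) zero (inj₁ ≡.refl)))
                (+-congʳ (sumFun-zero n K (λ g → G-low (suc zero ∷ᶠ g) zero (inj₂ ≡.refl)))) ⟩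
    0# + (0# + Σ+.sum (λ x → sumFun n K (λ g → G (up x ∷ᶠ g))))
      ≈⟨ trans (+-identityˡ _) (+-identityˡ _) ⟩
    Σ+.sum (λ x → sumFun n K (λ g → G (up x ∷ᶠ g)))
      ≈⟨ Σ+.sum-cong-≋ (λ x → sumFun-avoiding-01 n k (λ g → G (up x ∷ᶠ g)) (extensional-∷ G ext (up x))
                                                     (λ g i → G-low (up x ∷ᶠ g) (suc i))) ⟩
    Σ+.sum (λ x → sumFun n k (λ h → G (up x ∷ᶠ (up ∘ h))))
      ≈⟨ Σ+.sum-cong-≋ {k} (λ x → sumFun-cong n k λ h → ext (up x ∷ᶠ (up ∘ h)) (up ∘ (x ∷ᶠ h)) λ { zero → ≡.refl ; (suc i) → ≡.refl }) ⟩
    sumFun (suc n) k (λ h → G (up ∘ h)) ∎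
    where K : ℕ
          K = suc (suc k)

  signedMatching : (k : ℕ) → (Fin k → Fin k) → Carrier
  signedMatching k f = Σ+.onlyIf (isPerfectMatching? k f) (minusOnePow (cr k f))

  signedMatching-cong : ∀ k → Extensional k k (signedMatching k)
  signedMatching-cong k f g f≗g =
    Σ+.onlyIf-cong (isPerfectMatching? k f) (isPerfectMatching? k g)
      (mk⇔ (isPerfectMatching-cong k f≗g) (isPerfectMatching-cong k (≡.sym ∘ f≗g)))
      (λ _ → reflexive (≡.cong minusOnePow (≡.trans (cr≡crossings k f)
                         (≡.trans (crossings-cong k f≗g) (≡.sym (cr≡crossings k g))))))

  signedMatching-absurd : ∀ k f → ¬ IsPerfectMatching k f → signedMatching k f ≈ 0#
  signedMatching-absurd k f = Σ+.onlyIf-absurd (isPerfectMatching? k f)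

  minusOnePow-flip : ∀ {m n} → suc m ≡ n ⊎ m ≡ suc n → minusOnePow m ≈ - minusOnePow n
  minusOnePow-flip (inj₁ ≡.refl) = sym (-‿involutive _)
  minusOnePow-flip (inj₂ ≡.refl) = refl

  signedMatching-conj : ∀ {m} (f : Fin (suc (suc m)) → Fin (suc (suc m))) {x y} →
    f zero ≡ up x → f (suc zero) ≡ up y → signedMatching (suc (suc m)) (conj f) ≈ - signedMatching (suc (suc m)) f
  signedMatching-conj {m} f f0 f1 with isPerfectMatching? (suc (suc m)) f
  ... | no ¬pm = trans (signedMatching-absurd K (conj f) conj-not-matching) (sym -0#≈0#)
    where
    K : ℕ
    K = suc (suc m)
    -- conj is an involution, so it reflects being a matching
    conj-not-matching : ¬ IsPerfectMatching K (conj f)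
    conj-not-matching pm = ¬pm (isPerfectMatching-cong K (λ i → ≡.trans (τ-involutive _) (≡.cong f (τ-involutive i)))
                                                          (conj-matching (conj f) pm))
  ... | yes pm = begin
    signedMatching K (conj f)     ≈⟨ Σ+.onlyIf-holds (isPerfectMatching? K (conj f)) (conj-matching f pm) ⟩
    minusOnePow (cr K (conj f))   ≡⟨ ≡.cong minusOnePow (cr≡crossings K (conj f)) ⟩
    minusOnePow (crossings K (conj f)) ≈⟨ minusOnePow-flip (ExchangeParity.exchange-parity f pm f0 f1) ⟩
    - minusOnePow (crossings K f) ≡⟨ ≡.cong (-_ ∘ minusOnePow) (≡.sym (cr≡crossings K f)) ⟩
    - minusOnePow (cr K f) ∎
    where K : ℕ
          K = suc (suc m)

  signedMatching-withChord01 : ∀ {m} (h : Fin m → Fin m) → signedMatching (suc (suc m)) (withChord01 h) ≈ signedMatching m h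
  signedMatching-withChord01 {m} h =
    Σ+.onlyIf-cong (isPerfectMatching? (suc (suc m)) (withChord01 h)) (isPerfectMatching? m h) (withChord01-matching⇔ m h)
      (λ _ → reflexive (≡.cong minusOnePow (≡.trans (cr≡crossings _ (withChord01 h))
                         (≡.trans (crossings-withChord01 h) (≡.sym (cr≡crossings m h))))))

  module SplitAt01 {m : ℕ} where
    private
      K : ℕ
      K = suc (suc m)
      W : (Fin K → Fin K) → Carrier
      W = signedMatching K

    ifLow ifHigh : Fin K → Carrier → Carrier
    ifLow zero          w = w
    ifLow (suc zero)    w = w
    ifLow (suc (suc _)) w = 0#
    ifHigh zero          w = 0#
    ifHigh (suc zero)    w = 0#
    ifHigh (suc (suc _)) w = w

    low+high : ∀ u w → w ≈ ifLow u w + ifHigh u w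
    low+high zero          w = sym (+-identityʳ w)
    low+high (suc zero)    w = sym (+-identityʳ w)
    low+high (suc (suc _)) w = sym (+-identityˡ w)

    ifAscending : Fin K → Fin K → Carrier → Carrier
    ifAscending (suc (suc x)) (suc (suc y)) w = Σ+.onlyIf (x FinP.<? y) w
    ifAscending _             _             w = 0#

    ifAscending-cong : ∀ u v {w w'} → w ≈ w' → ifAscending u v w ≈ ifAscending u v w'
    ifAscending-cong (suc (suc x)) (suc (suc y)) w≈w' =
      Σ+.onlyIf-cong (x FinP.<? y) (x FinP.<? y) ⇔.refl (λ _ → w≈w')
    ifAscending-cong zero                 _             _ = refl
    ifAscending-cong (suc zero)           _             _ = refl
    ifAscending-cong (suc (suc x))        zero          _ = refl
    ifAscending-cong (suc (suc x))        (suc zero)    _ = refl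

    high-split : ∀ f → ifHigh (f zero) (W f) ≈ ifAscending (f zero) (f (suc zero)) (W f) + ifAscending (f (suc zero)) (f zero) (W f)
    high-split f = by-partners (f zero) (f (suc zero)) ≡.refl ≡.refl
      where
      vanishes : ¬ IsPerfectMatching K f → W f ≈ 0# + 0#
      vanishes ¬pm = trans (signedMatching-absurd K f ¬pm) (sym (+-identityˡ 0#))
      by-partners : ∀ u v → f zero ≡ u → f (suc zero) ≡ v → ifHigh u (W f) ≈ ifAscending u v (W f) + ifAscending v u (W f)
      by-partners zero          zero          _  _  = sym (+-identityˡ 0#)
      by-partners zero          (suc zero)    _  _  = sym (+-identityˡ 0#)
      by-partners zero          (suc (suc _)) _  _  = sym (+-identityˡ 0#)
      by-partners (suc zero)    zero          _  _  = sym (+-identityˡ 0#)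
      by-partners (suc zero)    (suc zero)    _  _  = sym (+-identityˡ 0#)
      by-partners (suc zero)    (suc (suc _)) _  _  = sym (+-identityˡ 0#)
      by-partners (suc (suc x)) zero          f0 f1 = vanishes (high-low-not-matching f f0 (inj₁ f1))
      by-partners (suc (suc x)) (suc zero)    f0 f1 = vanishes (high-low-not-matching f f0 (inj₂ f1))
      by-partners (suc (suc x)) (suc (suc y)) f0 f1 with FinP.<-cmp x y
      ... | tri< x<y _ y≮x =
        sym (trans (+-cong (Σ+.onlyIf-holds (x FinP.<? y) x<y) (Σ+.onlyIf-absurd (y FinP.<? x) y≮x)) (+-identityʳ _))
      ... | tri≈ x≮y x≡y y≮x = trans (vanishes (equal-partners-not-matching f (≡.trans f0 (≡.trans (≡.cong up x≡y) (≡.sym f1)))))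
        (sym (+-cong (Σ+.onlyIf-absurd (x FinP.<? y) x≮y) (Σ+.onlyIf-absurd (y FinP.<? x) y≮x)))
      ... | tri> x≮y _ y<x =
        sym (trans (+-cong (Σ+.onlyIf-absurd (x FinP.<? y) x≮y) (Σ+.onlyIf-holds (y FinP.<? x) y<x)) (+-identityˡ _))

    descending-conj : ∀ f → ifAscending (τ (f zero)) (τ (f (suc zero))) (W (conj f)) ≈ - ifAscending (f zero) (f (suc zero)) (W f)
    descending-conj f = by-partners (f zero) (f (suc zero)) ≡.refl ≡.refl
      where
      by-partners : ∀ u v → f zero ≡ u → f (suc zero) ≡ v → ifAscending (τ u) (τ v) (W (conj f)) ≈ - ifAscending u v (W f)
      by-partners (suc (suc x)) (suc (suc y)) f0 f1 with x FinP.<? y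
      ... | yes _ = signedMatching-conj f f0 f1
      ... | no _  = sym -0#≈0#
      by-partners zero          _             _ _ = sym -0#≈0#
      by-partners (suc zero)    _             _ _ = sym -0#≈0#
      by-partners (suc (suc x)) zero          _ _ = sym -0#≈0#
      by-partners (suc (suc x)) (suc zero)    _ _ = sym -0#≈0#

    -- The configurations with 0 and 1 matched to positions ≥ 2 cancel in
    -- pairs under the exchange of the labels 0 and 1.
    high-part-vanishes : sumFun K K (λ f → ifHigh (f zero) (W f)) ≈ 0#
    high-part-vanishes = begin
      sumFun K K (λ f → ifHigh (f zero) (W f))  ≈⟨ sumFun-cong K K high-split ⟩
      sumFun K K (λ f → A f + D f)              ≈⟨ sumFun-+ K K A D ⟩
      sumFun K K A + sumFun K K D               ≈⟨ +-congˡ (sym (sumFun-conj m D D-extensional)) ⟩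
      sumFun K K A + sumFun K K (D ∘ conj)      ≈⟨ sym (sumFun-+ K K A (D ∘ conj)) ⟩
      sumFun K K (λ f → A f + D (conj f))       ≈⟨ sumFun-zero K K (λ f → trans (+-congˡ (descending-conj f)) (-‿inverseʳ (A f))) ⟩
      0# ∎
      where
      A D : (Fin K → Fin K) → Carrier
      A f = ifAscending (f zero) (f (suc zero)) (W f)
      D f = ifAscending (f (suc zero)) (f zero) (W f)
      D-extensional : Extensional K K D
      D-extensional f g f≗g = trans (ifAscending-cong (f (suc zero)) (f zero) (signedMatching-cong K f g f≗g))
                                    (reflexive (≡.cong₂ (λ u v → ifAscending u v (W g)) (f≗g (suc zero)) (f≗g zero)))

    low-part : sumFun K K (λ f → ifLow (f zero) (W f)) ≈ sumFun m K (λ g → W (suc zero ∷ᶠ (zero ∷ᶠ g)))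
    low-part = begin
      sumFun K K (λ f → ifLow (f zero) (W f))
        ≈⟨ +-cong (sumFun-zero (suc m) K λ g → signedMatching-absurd K (zero ∷ᶠ g) 0-fixed)
                  (+-congˡ (Σ+.sum-zero {m} λ x → sumFun-zero (suc m) K {λ g → ifLow (up x) (W (up x ∷ᶠ g))} λ g → refl)) ⟩
      0# + (sumFun (suc m) K (λ g → W (suc zero ∷ᶠ g)) + 0#)
        ≈⟨ trans (+-identityˡ _) (+-identityʳ _) ⟩
      sumFun (suc m) K (λ g → W (suc zero ∷ᶠ g))
        ≈⟨ +-congˡ (+-cong (sumFun-zero m K λ h → signedMatching-absurd K (suc zero ∷ᶠ (suc zero ∷ᶠ h)) 1-fixed)
                           (Σ+.sum-zero λ y → sumFun-zero m K λ h → signedMatching-absurd K (suc zero ∷ᶠ (up y ∷ᶠ h)) 1-not-to-0)) ⟩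
      sumFun m K (λ h → W (suc zero ∷ᶠ (zero ∷ᶠ h))) + (0# + 0#)
        ≈⟨ trans (+-congˡ (+-identityʳ 0#)) (+-identityʳ _) ⟩
      sumFun m K (λ g → W (suc zero ∷ᶠ (zero ∷ᶠ g))) ∎
      where
      0-fixed : ∀ {g} → ¬ IsPerfectMatching K (zero ∷ᶠ g)
      0-fixed pm = proj₂ (pm zero) ≡.refl
      1-fixed : ∀ {h} → ¬ IsPerfectMatching K (suc zero ∷ᶠ (suc zero ∷ᶠ h))
      1-fixed pm = proj₂ (pm (suc zero)) ≡.refl
      1-not-to-0 : ∀ {y : Fin m} {h} → ¬ IsPerfectMatching K (suc zero ∷ᶠ (up y ∷ᶠ h))
      1-not-to-0 pm with proj₁ (pm zero)
      ... | ()

    chord01-part : sumFun m K (λ g → W (suc zero ∷ᶠ (zero ∷ᶠ g))) ≈ sumFun m m (signedMatching m)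
    chord01-part = begin
      sumFun m K (λ g → W (suc zero ∷ᶠ (zero ∷ᶠ g)))
        ≈⟨ sumFun-avoiding-01 m m (λ g → W (suc zero ∷ᶠ (zero ∷ᶠ g))) summand-extensional partner-low-not-matching ⟩
      sumFun m m (λ h → W (suc zero ∷ᶠ (zero ∷ᶠ (up ∘ h))))
        ≈⟨ sumFun-cong m m (λ h → trans (signedMatching-cong K _ (withChord01 h) (is-withChord01 h)) (signedMatching-withChord01 h)) ⟩
      sumFun m m (signedMatching m) ∎
      where
      summand-extensional : Extensional m K (λ g → W (suc zero ∷ᶠ (zero ∷ᶠ g)))
      summand-extensional g g' g≗g' = signedMatching-cong K (suc zero ∷ᶠ (zero ∷ᶠ g)) (suc zero ∷ᶠ (zero ∷ᶠ g'))
        λ { zero → ≡.refl ; (suc zero) → ≡.refl ; (suc (suc i)) → g≗g' i }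
      is-withChord01 : ∀ h i → (suc zero ∷ᶠ (zero ∷ᶠ (up ∘ h))) i ≡ withChord01 h i
      is-withChord01 h zero          = ≡.refl
      is-withChord01 h (suc zero)    = ≡.refl
      is-withChord01 h (suc (suc i)) = ≡.refl
      -- a point i ≥ 2 matched to 0 or 1 would be 1 or 0
      partner-low-not-matching : ∀ g i → Low (g i) → W (suc zero ∷ᶠ (zero ∷ᶠ g)) ≈ 0#
      partner-low-not-matching g i low = signedMatching-absurd K _ (not-matching low)
        where
        not-matching : Low (g i) → ¬ IsPerfectMatching K (suc zero ∷ᶠ (zero ∷ᶠ g))
        not-matching (inj₁ gi≡0) pm with ≡.trans (≡.sym (≡.cong (suc zero ∷ᶠ (zero ∷ᶠ g)) gi≡0)) (proj₁ (pm (up i)))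
        ... | ()
        not-matching (inj₂ gi≡1) pm with ≡.trans (≡.sym (≡.cong (suc zero ∷ᶠ (zero ∷ᶠ g)) gi≡1)) (proj₁ (pm (up i)))
        ... | ()

  pfaffian : ∀ q → sumFun (q ℕ.* 2) (q ℕ.* 2) (signedMatching (q ℕ.* 2)) ≈ 1#
  pfaffian zero    = refl
  pfaffian (suc q) = begin
    sumFun K K (signedMatching K)
      ≈⟨ sumFun-cong K K (λ f → low+high (f zero) (signedMatching K f)) ⟩
    sumFun K K (λ f → ifLow (f zero) (signedMatching K f) + ifHigh (f zero) (signedMatching K f))
      ≈⟨ sumFun-+ K K (λ f → ifLow (f zero) (signedMatching K f)) (λ f → ifHigh (f zero) (signedMatching K f)) ⟩
    sumFun K K (λ f → ifLow (f zero) (signedMatching K f)) + sumFun K K (λ f → ifHigh (f zero) (signedMatching K f))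
      ≈⟨ +-cong (trans low-part chord01-part) high-part-vanishes ⟩
    sumFun m m (signedMatching m) + 0#
      ≈⟨ trans (+-identityʳ _) (pfaffian q) ⟩
    1# ∎
    where
    m K : ℕ
    m = q ℕ.* 2
    K = suc (suc m)
    open SplitAt01 {m}

  signed-matching-count : ∀ d → 2 ∣ d → sumR (map (λ M → minusOnePow (cr d M)) (matchings d)) ≈ 1#
  signed-matching-count .(q ℕ.* 2) (divides q ≡.refl) = begin
    sumR (map (λ M → minusOnePow (cr d M)) (matchings d))
      ≈⟨ Σ+.fold-filter (isPerfectMatching? d) (λ M → minusOnePow (cr d M)) (allFunctions d (λ _ → allFin d)) ⟩
    Σ+.fold (map (signedMatching d) (allFunctions d (λ _ → allFin d)))
      ≈⟨ fold-allFunctions d d (signedMatching d) (signedMatching-cong d) ⟩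
    sumFun d d (signedMatching d)
      ≈⟨ pfaffian q ⟩
    1# ∎
    where d : ℕ
          d = q ℕ.* 2

  fold-*ˡ : ∀ {b} {B : Set b} a (g : B → Carrier) xs → sumR (map (λ x → a * g x) xs) ≈ a * sumR (map g xs)
  fold-*ˡ a g []       = sym (zeroʳ a)
  fold-*ˡ a g (x ∷ xs) = trans (+-congˡ (fold-*ˡ a g xs)) (sym (distribˡ a _ _))

  fold-*ʳ : ∀ {b} {B : Set b} a (g : B → Carrier) xs → sumR (map (λ x → g x * a) xs) ≈ sumR (map g xs) * a
  fold-*ʳ a g []       = sym (zeroˡ a)
  fold-*ʳ a g (x ∷ xs) = trans (+-congˡ (fold-*ʳ a g xs)) (sym (distribʳ a _ _))

  sum-of-choices : ∀ n {B : Fin n → Set} (ls : (i : Fin n) → List (B i)) (F : (i : Fin n) → B i → Carrier) →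
    sumR (map (λ Ms → Π*.sum (λ v → F v (Ms v))) (allFunctions n ls)) ≈ Π*.sum (λ v → sumR (map (F v) (ls v)))
  sum-of-choices zero    ls F = +-identityʳ _
  sum-of-choices (suc n) {B} ls F = begin
    sumR (map _ (allFunctions (suc n) ls))        ≈⟨ Σ+.fold-concatMap _ _ (ls zero) ⟩
    sumR (map _ (ls zero))                        ≈⟨ Σ+.fold-map-cong (ls zero) (per-choice _ (λ _ _ → ≡.refl) (λ _ _ _ → ≡.refl)) ⟩
    sumR (map (λ b → F zero b * S) (ls zero))     ≈⟨ fold-*ʳ S (F zero) (ls zero) ⟩
    sumR (map (F zero) (ls zero)) * S ∎
    where
    L : List ((i : Fin n) → B (suc i))
    L = allFunctions n (λ i → ls (suc i))
    S : Carrier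
    S = Π*.sum (λ v → sumR (map (F (suc v)) (ls (suc v))))
    -- the enumeration prepends each first choice b by a local copy of the dependent cons
    per-choice : ∀ (cons : B zero → ((i : Fin n) → B (suc i)) → (i : Fin (suc n)) → B i) →
      (∀ b f → cons b f zero ≡ b) → (∀ b f i → cons b f (suc i) ≡ f i) → ∀ b →
      sumR (map (λ Ms → Π*.sum (λ v → F v (Ms v))) (map (cons b) L)) ≈ F zero b * S
    per-choice cons cons-zero cons-suc b = begin
      sumR (map (λ Ms → Π*.sum (λ v → F v (Ms v))) (map (cons b) L)) ≡⟨ ≡.cong sumR (≡.sym (map-∘ L)) ⟩
      sumR (map (λ f → F zero (cons b f zero) * Π*.sum (λ v → F (suc v) (cons b f (suc v)))) L)
        ≈⟨ Σ+.fold-map-cong L (λ f → reflexive (≡.cong₂ _*_ (≡.cong (F zero) (cons-zero b f))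
                                                (Π*.sum-cong-≗ (λ v → ≡.cong (F (suc v)) (cons-suc b f v))))) ⟩
      sumR (map (λ f → F zero b * Π*.sum (λ v → F (suc v) (f v))) L) ≈⟨ fold-*ˡ (F zero b) _ L ⟩
      F zero b * sumR (map (λ f → Π*.sum (λ v → F (suc v) (f v))) L) ≈⟨ *-congˡ (sum-of-choices n (λ i → ls (suc i)) (λ i → F (suc i))) ⟩
      F zero b * S ∎

  product-over-pairs : ∀ d (t : Fin d → Carrier) (M : Fin d → Fin d) → IsPerfectMatching d M →
    prodR (map (λ i → t i * t (M i)) (filter (λ i → i FinP.<? M i) (allFin d))) ≈ Π*.sum t
  product-over-pairs d t M pm = begin
    prodR (map (λ i → t i * t (M i)) (filter (λ i → i FinP.<? M i) (allFin d)))
      ≈⟨ Π*.fold-filter (λ i → i FinP.<? M i) (λ i → t i * t (M i)) (allFin d) ⟩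
    prodR (map (λ i → Π*.onlyIf (i FinP.<? M i) (t i * t (M i))) (allFin d))
      ≡⟨ Π*.fold-allFin d _ ⟩
    Π*.sum (λ i → Π*.onlyIf (i FinP.<? M i) (t i * t (M i)))
      ≈⟨ Π*.sum-cong-≋ (λ i → onlyIf-* (i FinP.<? M i)) ⟩
    Π*.sum (λ i → lower i * upper i)             ≈⟨ Π*.∑-distrib-+ lower upper ⟩
    Π*.sum lower * Π*.sum upper                  ≈⟨ *-congˡ (Π*.∑-permute upper involution) ⟩
    Π*.sum lower * Π*.sum (upper ∘ M)            ≈⟨ *-congˡ (Π*.sum-cong-≋ upper∘M) ⟩
    Π*.sum lower * Π*.sum higher                 ≈⟨ sym (Π*.∑-distrib-+ lower higher) ⟩
    Π*.sum (λ i → lower i * higher i)            ≈⟨ Π*.sum-cong-≋ lower*higher ⟩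
    Π*.sum t ∎
    where
    -- lower i = t i at a smaller endpoint i, upper i = t (M i) at a smaller
    -- endpoint i, higher i = t i at a larger endpoint i (1 elsewhere); M
    -- carries upper onto higher, and every position is smaller or larger.
    lower upper higher : Fin d → Carrier
    lower i  = Π*.onlyIf (i FinP.<? M i) (t i)
    upper i  = Π*.onlyIf (i FinP.<? M i) (t (M i))
    higher i = Π*.onlyIf (M i FinP.<? i) (t i)
    onlyIf-* : ∀ {A : Set} (d : Dec A) {x y} → Π*.onlyIf d (x * y) ≈ Π*.onlyIf d x * Π*.onlyIf d y
    onlyIf-* (yes _) = refl
    onlyIf-* (no _)  = sym (*-identityˡ 1#)
    involution : Permutation′ d
    involution = permutation M M (proj₁ ∘ pm) (proj₁ ∘ pm)
    upper∘M : ∀ i → upper (M i) ≈ higher i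
    upper∘M i = Π*.onlyIf-cong (M i FinP.<? M (M i)) (M i FinP.<? i)
      (mk⇔ (≡.subst (M i Fin.<_) (proj₁ (pm i))) (≡.subst (M i Fin.<_) (≡.sym (proj₁ (pm i)))))
      (λ _ → reflexive (≡.cong t (proj₁ (pm i))))
    lower*higher : ∀ i → lower i * higher i ≈ t i
    lower*higher i with i FinP.<? M i | M i FinP.<? i
    ... | yes i<Mi | yes Mi<i = ⊥-elim (ℕP.<-asym i<Mi Mi<i)
    ... | yes _    | no _     = *-identityʳ _
    ... | no _     | yes _    = *-identityˡ _
    ... | no i≮Mi  | no Mi≮i with FinP.<-cmp i (M i)
    ...   | tri< i<Mi _ _    = ⊥-elim (i≮Mi i<Mi)
    ...   | tri≈ _ i≡Mi _    = ⊥-elim (proj₂ (pm i) (≡.sym i≡Mi))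
    ...   | tri> _ _ Mi<i    = ⊥-elim (Mi≮i Mi<i)

  module OnGraph (H : EmbeddedGraph) (s : Fin (nE H) → Carrier) where

    vertexProduct : Fin (nV H) → Carrier
    vertexProduct v = Π*.sum (λ i → s (edgeAt H v i))

    -- At an even vertex the crossing signs of all matchings add up to 1, and
    -- every matching uses each incident position once.
    vertex-sum : ∀ v → 2 ∣ deg H v → sumR (map (wc H s v) (matchings (deg H v))) ≈ vertexProduct v
    vertex-sum v even = begin
      sumR (map (wc H s v) (matchings d))
        ≈⟨ Σ+.fold-filter-cong (isPerfectMatching? d) (allFunctions d (λ _ → allFin d))
             (λ M pm → *-congˡ (product-over-pairs d (λ i → s (edgeAt H v i)) M pm)) ⟩
      sumR (map (λ M → minusOnePow (cr d M) * vertexProduct v) (matchings d)) ≈⟨ fold-*ʳ (vertexProduct v) _ (matchings d) ⟩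
      sumR (map (λ M → minusOnePow (cr d M)) (matchings d)) * vertexProduct v ≈⟨ *-congʳ (signed-matching-count d even) ⟩
      1# * vertexProduct v                                                   ≈⟨ *-identityˡ _ ⟩
      vertexProduct v ∎
      where d : ℕ
            d = deg H v

    _≟½_ : (p q : Fin (nE H) × Bool) → Dec (p ≡ q)
    _≟½_ = ≡-dec FinP._≟_ BoolP._≟_

    atHalfEdge : ∀ v (i : Fin (deg H v)) (e : Fin (nE H)) (b : Bool) → Carrier
    atHalfEdge v i e b = Π*.onlyIf (rot H v i ≟½ (e , b)) (s e)

    same-end : ∀ p e → Π*.onlyIf (p ≟½ (e , proj₂ p)) (s e) ≈ Π*.onlyIf (e FinP.≟ proj₁ p) (s (proj₁ p))
    same-end (e₀ , b) e = Π*.onlyIf-cong ((e₀ , b) ≟½ (e , b)) (e FinP.≟ e₀)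
      (mk⇔ (λ q → ≡.sym (≡.cong proj₁ q)) (λ q → ≡.cong (_, b) (≡.sym q)))
      (λ q → reflexive (≡.cong s (≡.sym (≡.cong proj₁ q))))

    both-ends : ∀ (p : Fin (nE H) × Bool) e →
      Π*.onlyIf (p ≟½ (e , true)) (s e) * Π*.onlyIf (p ≟½ (e , false)) (s e) ≈ Π*.onlyIf (e FinP.≟ proj₁ p) (s (proj₁ p))
    both-ends (e₀ , true) e = trans (*-cong (same-end (e₀ , true) e) (Π*.onlyIf-absurd ((e₀ , true) ≟½ (e , false)) λ ())) (*-identityʳ _)
    both-ends (e₀ , false) e = trans (*-cong (Π*.onlyIf-absurd ((e₀ , false) ≟½ (e , true)) λ ()) (same-end (e₀ , false) e)) (*-identityˡ _)

    edge-at-position : ∀ v i → s (edgeAt H v i) ≈ Π*.sum (λ e → atHalfEdge v i e true * atHalfEdge v i e false)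
    edge-at-position v i = sym (trans (Π*.sum-cong-≋ (both-ends (rot H v i))) (Π*.sum-delta (edgeAt H v i) _))

    half-edge-once : ∀ e b → Π*.sum (λ v → Π*.sum (λ i → atHalfEdge v i e b)) ≈ s e
    half-edge-once e b = trans (Π*.sum-cong-≋ at-vertex) (Π*.sum-delta (ends H e b) (s e))
      where
      at-vertex : ∀ v → Π*.sum (λ i → atHalfEdge v i e b) ≈ Π*.onlyIf (v FinP.≟ ends H e b) (s e)
      at-vertex v with v FinP.≟ ends H e b
      ... | yes ≡.refl = trans (Π*.sum-cong-≋ λ i → Π*.onlyIf-cong (rot H v i ≟½ (e , b)) (i FinP.≟ i₀)
                                  (mk⇔ (λ q → rot-inj H v i i₀ (≡.trans q (≡.sym (proj₂ (rot-surj H e b)))))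
                                       (λ q → ≡.trans (≡.cong (rot H v) q) (proj₂ (rot-surj H e b))))
                                  (λ _ → refl))
                               (Π*.sum-delta i₀ (s e))
        where i₀ : Fin (deg H (ends H e b))
              i₀ = proj₁ (rot-surj H e b)
      ... | no v≢end = Π*.sum-zero λ i → Π*.onlyIf-absurd (rot H v i ≟½ (e , b))
                         λ q → v≢end (≡.trans (≡.sym (rot-at H v i)) (≡.cong (λ p → ends H (proj₁ p) (proj₂ p)) q))

    -- Handshake: the positions around all vertices are the two ends of all edges.
    handshake : Π*.sum vertexProduct ≈ Π*.sum (λ e → s e * s e)
    handshake = begin
      Π*.sum (λ v → Π*.sum (λ i → s (edgeAt H v i)))
        ≈⟨ Π*.sum-cong-≋ (λ v → Π*.sum-cong-≋ (edge-at-position v)) ⟩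
      Π*.sum (λ v → Π*.sum (λ i → Π*.sum (λ e → J v i e true * J v i e false)))
        ≈⟨ Π*.sum-cong-≋ (λ v → Π*.∑-comm (λ i e → J v i e true * J v i e false)) ⟩
      Π*.sum (λ v → Π*.sum (λ e → Π*.sum (λ i → J v i e true * J v i e false)))
        ≈⟨ Π*.∑-comm (λ v e → Π*.sum (λ i → J v i e true * J v i e false)) ⟩
      Π*.sum (λ e → Π*.sum (λ v → Π*.sum (λ i → J v i e true * J v i e false)))
        ≈⟨ Π*.sum-cong-≋ (λ e → trans (Π*.sum-cong-≋ λ v → Π*.∑-distrib-+ (λ i → J v i e true) (λ i → J v i e false))
                                      (Π*.∑-distrib-+ (λ v → Π*.sum (λ i → J v i e true)) (λ v → Π*.sum (λ i → J v i e false)))) ⟩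
      Π*.sum (λ e → Π*.sum (λ v → Π*.sum (λ i → J v i e true)) * Π*.sum (λ v → Π*.sum (λ i → J v i e false)))
        ≈⟨ Π*.sum-cong-≋ (λ e → *-cong (half-edge-once e true) (half-edge-once e false)) ⟩
      Π*.sum (λ e → s e * s e) ∎
      where J : ∀ v (i : Fin (deg H v)) (e : Fin (nE H)) (b : Bool) → Carrier
            J = atHalfEdge

proposition2p7 : ∀ {c ℓ} (R : CommutativeRing c ℓ) (H : EmbeddedGraph) →
    (∀ v → 2 ∣ deg H v) →
    (K sqrtK : Fin (nE H) → CommutativeRing.Carrier R) →
    (∀ e → CommutativeRing._≈_ R (CommutativeRing._*_ R (sqrtK e) (sqrtK e)) (K e)) →
    CommutativeRing._≈_ R (Weights.edgeProduct R H K) (Weights.matchingSum R H sqrtK)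
proposition2p7 R H even K sqrtK sqrtK² = begin
  edgeProduct H K                                        ≡⟨ Π*.fold-allFin (nE H) K ⟩
  Π*.sum K                                               ≈⟨ Π*.sum-cong-≋ (sym ∘ sqrtK²) ⟩
  Π*.sum (λ e → sqrtK e * sqrtK e)                       ≈⟨ sym handshake ⟩
  Π*.sum vertexProduct                                   ≈⟨ Π*.sum-cong-≋ (λ v → sym (vertex-sum v (even v))) ⟩
  Π*.sum (λ v → sumR (map (wc H sqrtK v) (matchings (deg H v))))
    ≈⟨ sym (sum-of-choices (nV H) (λ v → matchings (deg H v)) (wc H sqrtK)) ⟩
  sumR (map (λ Ms → Π*.sum (λ v → wc H sqrtK v (Ms v))) (allFunctions (nV H) (λ v → matchings (deg H v))))
    ≈⟨ Σ+.fold-map-cong (allFunctions (nV H) (λ v → matchings (deg H v)))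
         (λ Ms → reflexive (≡.sym (Π*.fold-allFin (nV H) (λ v → wc H sqrtK v (Ms v))))) ⟩
  matchingSum H sqrtK ∎
  where
  open CommutativeRing R
  open Weights R
  open WithRing R
  open OnGraph H sqrtK
  open import Relation.Binary.Reasoning.Setoid setoid
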